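{- Let $G=(V,E)$ be a trivalent $2$-edge-connected graph. A non-empty subset $A\subseteq V$ is a circuit of $M_G$ if and only if both of the following hold: (i) either $A$ is a cycle, or $A$ is acyclic and $\omega(A)+1=\omega(V- A)$; (ii) no proper non-empty subset of $A$ is a cycle, and no proper non-empty subset $A'$ of $A$ is acyclic with $\omega(A')+1=\omega(V- A')$.
   Context: Graphs are finite and undirected and may have parallel edges (no loops occur here, since a trivalent $2$-edge-connected graph is loopless); trivalent means every vertex has degree $3$. $r^*$ is the rank function of the bond (cographic) matroid of $G$, the dual of the cycle matroid. For $A\subseteq V$, $\delta(A)$ is the set of edges incident to at least one vertex of $A$. $G[A]$ is the induced subgraph on $A$, and $\omega(A)$ is the number of connected components of $G[A]$, with $\omega(\emptyset)=0$. A set $C=\{v_1,\dots,v_r\}\subseteq V$ of distinct vertices is a cycle if, after relabeling, there is an edge between $v_i$ and $v_{i+1}$ for all $1\le i\le r$, where $v_{r+1}=v_1$. A vertex subset is cyclic if its induced subgraph contains a cycle, and acyclic otherwise. The graph curve matroid $M_G$ is the matroid on $V$ whose circuits are the non-empty subsets $A\subseteq V$ that are inclusion-minimal among non-empty subsets satisfying $r^*(\delta(A))\le|A|$. -}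

module Defs where

open import Data.Nat using (ℕ; zero; suc; _+_; _≤_)
open import Data.Fin using (Fin; zero; suc; inject₁; fromℕ; _≟_)
open import Data.Fin.Subset using (Subset; _∈_; _⊂_; Nonempty; ∣_∣; ∁)
open import Data.Vec using (tabulate; lookup)
open import Data.Bool using (Bool; true; _∨_)
open import Data.Product using (Σ; ∃; _×_; _,_)
open import Data.Sum using (_⊎_)
open import Data.Unit using (⊤)
open import Data.Empty using (⊥)
open import Relation.Nullary using (¬_; ⌊_⌋)
open import Relation.Binary.PropositionalEquality using (_≡_; _≢_)
open import Function.Bundles using (_⇔_)

-- A finite undirected multigraph: vertices Fin n, edges Fin m,
-- each edge e has endpoints src e and tgt e (orientation is irrelevant).
record Graph : Set where
  field
    n   : ℕ
    m   : ℕ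
    src : Fin m → Fin n
    tgt : Fin m → Fin n

module _ (G : Graph) where
  open Graph G

  V = Fin n
  E = Fin m

  Joins : E → V → V → Set
  Joins e u v = (src e ≡ u × tgt e ≡ v) ⊎ (src e ≡ v × tgt e ≡ u)

  -- degree (a loop would count twice)
  degree : V → ℕ
  degree v = ∣ tabulate (λ e → ⌊ src e ≟ v ⌋) ∣ + ∣ tabulate (λ e → ⌊ tgt e ≟ v ⌋) ∣

  Trivalent : Set
  Trivalent = ∀ v → degree v ≡ 3

  data Reach (P : E → Set) : V → V → Set where
    here : ∀ {u} → Reach P u u
    step : ∀ {u w v} (e : E) → P e → Joins e u w → Reach P w v → Reach P u v

  Connected : Set
  Connected = ∀ u v → Reach (λ _ → ⊤) u v

  TwoEdgeConnected : Set
  TwoEdgeConnected = Connected × (∀ e u v → Reach (λ f → f ≢ e) u v)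

  NumCompSpan : Subset m → ℕ → Set
  NumCompSpan F c =
    Σ (V → Fin c) λ lab →
      (∀ j → ∃ λ v → lab v ≡ j) ×
      (∀ u v → (lab u ≡ lab v) ⇔ Reach (λ e → e ∈ F) u v)

  -- rank of F in the cycle matroid: r(F) = |V| - c(V,F)
  CycleRank : Subset m → ℕ → Set
  CycleRank F r = ∃ λ c → NumCompSpan F c × r + c ≡ n

  allE : Subset m
  allE = tabulate (λ _ → true)

  -- rank in the bond matroid (dual of the cycle matroid):
  -- r*(X) = |X| + r(E - X) - r(E)
  BondRank : Subset m → ℕ → Set
  BondRank X s = ∃ λ r₁ → ∃ λ r₀ →
    CycleRank (∁ X) r₁ × CycleRank allE r₀ × s + r₀ ≡ ∣ X ∣ + r₁

  δ : Subset n → Subset m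
  δ A = tabulate (λ e → lookup A (src e) ∨ lookup A (tgt e))

  Dep : Subset n → Set
  Dep A = ∃ λ s → BondRank (δ A) s × s ≤ ∣ A ∣

  IsCircuit : Subset n → Set
  IsCircuit A = Nonempty A × Dep A × (∀ B → B ⊂ A → Nonempty B → ¬ Dep B)

  InInduced : Subset n → E → Set
  InInduced A e = src e ∈ A × tgt e ∈ A

  -- G[A] has exactly k connected components (k = 0 iff A = ∅)
  NumComp : Subset n → ℕ → Set
  NumComp A k =
    Σ ((v : V) → v ∈ A → Fin k) λ lab →
      (∀ j → ∃ λ v → Σ (v ∈ A) λ p → lab v p ≡ j) ×
      (∀ u v (p : u ∈ A) (q : v ∈ A) → (lab u p ≡ lab v q) ⇔ Reach (InInduced A) u v)

  CompCond : Subset n → Set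
  CompCond A = ∃ λ k → ∃ λ l → NumComp A k × NumComp (∁ A) l × k + 1 ≡ l

  record CycleData : Set where
    field
      len   : ℕ
      vs    : Fin (suc len) → V
      es    : Fin (suc len) → E
      vs-inj : ∀ i j → vs i ≡ vs j → i ≡ j
      es-inj : ∀ i j → es i ≡ es j → i ≡ j
      joins : ∀ (i : Fin len) → Joins (es (inject₁ i)) (vs (inject₁ i)) (vs (suc i))
      close : Joins (es (fromℕ len)) (vs (fromℕ len)) (vs zero)

  IsCycle : Subset n → Set
  IsCycle A = Σ CycleData λ C → ∀ v → v ∈ A ⇔ (∃ λ i → CycleData.vs C i ≡ v)

  Cyclic : Subset n → Set
  Cyclic A = Σ CycleData λ C → ∀ i → CycleData.vs C i ∈ A

  Acyclic : Subset n → Set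
  Acyclic A = ¬ Cyclic A

-- Write D, Z and e for |δ(A)|, |A| and the number of edges of G[A], and κ for the number of components
-- of (V, E − δ(A)).  As G is connected, r*(δ(A)) = D + 1 − κ, so A is dependent iff D + 1 ≤ Z + κ.
-- Trivalence gives D + e = 3Z and κ = ω(V − A) + Z, so A is dependent iff Z + 1 ≤ e + ω(V − A).
-- Hence a cycle is dependent: e ≥ Z, and ω(V − A) ≥ 1 unless A = V, where 2e = 3Z.  An acyclic A has
-- ω(A) + e = Z, so for it the tight case D + 1 = Z + κ says exactly ω(A) + 1 = ω(V − A).  If
-- D + 1 < Z + κ, then A minus a vertex is still dependent, the case A = {v} being excluded by
-- 2-edge-connectivity.  So every circuit is tight and every dependent set contains a tight one, which
-- gives both directions.

module Submission where

open import Defs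
open import Data.Fin.Subset using (Subset; _⊂_; Nonempty)
open import Data.Product using (_×_)
open import Data.Sum using (_⊎_)
open import Relation.Nullary using (¬_)
open import Function.Bundles using (_⇔_)

open import Axiom.UniquenessOfIdentityProofs using (module Decidable⇒UIP)
import Data.Bool as Bool
open import Data.Bool using (Bool; true; false; _∨_; _∧_; not)
open import Data.Bool.Properties
  using (¬-not; not-involutive; ∨-identityʳ; ∨-zeroʳ; ∨-assoc; ∨-inverseˡ; ∧-identityʳ; ∧-zeroʳ; T-≡)
open import Data.Fin using (Fin; zero; suc; inject₁; fromℕ; toℕ; punchOut; punchIn; _≟_)
open import Data.Fin.Properties
  using (any?; suc-injective; 0≢1+n; inject₁-injective; toℕ-inject₁; toℕ<n; injective⇒≤;
         punchOut-injective; punchOut-cong; punchOut-punchIn; punchInᵢ≢i)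
open import Data.Fin.Subset using (_∈_; _⊆_; ∁; ∣_∣)
open import Data.Fin.Subset.Properties using (_∈?_; ⊆-antisym; ⊂-trans; nonempty?)
open import Data.Fin.Subset.Induction using (⊂-wellFounded; Acc; acc)
open import Data.Nat using (ℕ; zero; suc; _+_; _*_; _∸_; _≤_; _<_; z≤n; s≤s; s≤s⁻¹)
import Data.Nat.Properties as ℕ
open import Data.Nat.Properties
  using (+-*-semiring; +-commutativeSemigroup; +-comm; +-assoc; +-suc; +-identityʳ; *-identityʳ;
         *-distribʳ-+; +-cancelˡ-≡; +-cancelʳ-≡; +-cancelˡ-≤; +-cancelʳ-≤; +-mono-≤; +-monoˡ-≤;
         +-monoʳ-≤; ≤-refl; ≤-reflexive; ≤-trans; ≤-antisym; <-irrefl; ≰⇒>; <⇒≱; >⇒≢; n<1+n;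
         m<n⇒m<1+n; n≤1+n; m≤m+n; m≤n⇒m<n∨m≡n; m∸n+n≡m; m≤n+o⇒m∸n≤o; module ≤-Reasoning)
open import Data.Nat.Tactic.RingSolver using (solve-∀)
open import Data.Product using (Σ; ∃; _,_; proj₁; proj₂)
import Data.Sum as Sum
open import Data.Sum using (inj₁; inj₂)
open import Data.Vec using (lookup; tabulate)
open import Data.Vec.Functional using (_∷_)
open import Data.Vec.Properties using ([]=⇒lookup; lookup⇒[]=; lookup∘tabulate; tabulate∘lookup; lookup-map)
open import Function using (_∘_; mk⇔; Equivalence)
open import Function.Properties.Equivalence using () renaming (trans to ⇔-trans; sym to ⇔-sym)
open import Level using (Level)
open import Relation.Binary.PropositionalEquality
  using (_≡_; _≢_; refl; sym; trans; cong; cong₂; subst; subst₂; module ≡-Reasoning)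
open import Relation.Nullary using (Dec; yes; no; ⌊_⌋; contradiction)
open import Relation.Nullary.Decidable
  using (dec-true; dec-false; isYes≗does; ⌊⌋-map′; toWitness; fromWitness; _×-dec_; ¬?)

open import Algebra.Properties.CommutativeSemigroup +-commutativeSemigroup using (interchange)
open import Algebra.Properties.Semiring.Sum +-*-semiring
  using (sum; sum-cong-≗; ∑-distrib-+; ∑-comm; *-distribˡ-sum; *-distribʳ-sum; sum-replicate-zero)
open Equivalence using (to; from)

private variable
  ℓ : Level
  N M : ℕ

bit : Bool → ℕ
bit true  = 1
bit false = 0

count : (Fin N → Bool) → ℕ
count p = sum (bit ∘ p)

_∪_ _∩_ : (Fin N → Bool) → (Fin N → Bool) → Fin N → Bool
(p ∪ q) i = p i ∨ q i
(p ∩ q) i = p i ∧ q i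

⁅_⁆ : Fin N → Fin N → Bool
⁅ x ⁆ y = ⌊ x ≟ y ⌋

insert : Fin N → (Fin N → Bool) → Fin N → Bool
insert x p = p ∪ ⁅ x ⁆

remove : Fin N → (Fin N → Bool) → Fin N → Bool
remove x p = p ∩ (not ∘ ⁅ x ⁆)

≡true⇒≢false : {b : Bool} → b ≡ true → b ≢ false
≡true⇒≢false refl ()

∧-true⁻ : {a b : Bool} → a ∧ b ≡ true → a ≡ true × b ≡ true
∧-true⁻ {true} {true} _ = refl , refl

∨-mono : {a b a′ b′ : Bool} → (a ≡ true → a′ ≡ true) → (b ≡ true → b′ ≡ true) →
         a ∨ b ≡ true → a′ ∨ b′ ≡ true
∨-mono {true}         a⇒a′ _    _   = cong (_∨ _) (a⇒a′ refl)
∨-mono {false} {true} _    b⇒b′ _   = trans (cong (_ ∨_) (b⇒b′ refl)) (∨-zeroʳ _)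

⇒-partition : {a b : Bool} → (b ≡ true → a ≡ true) →
              (b ∨ (a ∧ not b) ≡ a) × (not b ≡ not a ∨ (a ∧ not b))
⇒-partition {true}  {true}  _   = refl , refl
⇒-partition {true}  {false} _   = refl , refl
⇒-partition {false} {false} _   = refl , refl
⇒-partition {false} {true}  b⇒a = contradiction (b⇒a refl) λ ()

⁅x⁆x : (x : Fin N) → ⁅ x ⁆ x ≡ true
⁅x⁆x x = trans (isYes≗does (x ≟ x)) (dec-true (x ≟ x) refl)

⁅x⁆y : {x y : Fin N} → x ≢ y → ⁅ x ⁆ y ≡ false
⁅x⁆y {x = x} {y} x≢y = trans (isYes≗does (x ≟ y)) (dec-false (x ≟ y) x≢y)

⁅suc⁆suc : (x y : Fin N) → ⁅ suc x ⁆ (suc y) ≡ ⁅ x ⁆ y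
⁅suc⁆suc x y = ⌊⌋-map′ (cong suc) suc-injective (x ≟ y)

insert-⊇ : (x : Fin N) (p : Fin N → Bool) {y : Fin N} → p y ≡ true → insert x p y ≡ true
insert-⊇ x p py = cong (_∨ ⁅ x ⁆ _) py

insert-∋ : (x : Fin N) (p : Fin N → Bool) → insert x p x ≡ true
insert-∋ x p = trans (cong (p x ∨_) (⁅x⁆x x)) (∨-zeroʳ (p x))

insert-≢ : {x y : Fin N} (p : Fin N → Bool) → x ≢ y → insert x p y ≡ p y
insert-≢ p x≢y = trans (cong (p _ ∨_) (⁅x⁆y x≢y)) (∨-identityʳ (p _))

insert⁻ : (x : Fin N) (p : Fin N → Bool) {y : Fin N} → insert x p y ≡ true → p y ≡ true ⊎ x ≡ y
insert⁻ x p {y} _ with p y | x ≟ y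
... | true  | _        = inj₁ refl
... | false | yes x≡y  = inj₂ x≡y

remove-self : (x : Fin N) (p : Fin N → Bool) → remove x p x ≡ false
remove-self x p = trans (cong (λ b → p x ∧ not b) (⁅x⁆x x)) (∧-zeroʳ (p x))

remove-≢ : {x y : Fin N} (p : Fin N → Bool) → x ≢ y → remove x p y ≡ p y
remove-≢ p x≢y = trans (cong (λ b → p _ ∧ not b) (⁅x⁆y x≢y)) (∧-identityʳ (p _))

insert-remove : (x : Fin N) (p : Fin N → Bool) → p x ≡ true → ∀ i → insert x (remove x p) i ≡ p i
insert-remove x p px≡true i with x ≟ i
... | yes refl = trans (∨-zeroʳ _) (sym px≡true)
... | no  _    = trans (∨-identityʳ _) (∧-identityʳ (p i))

remove-empty⇒⁅⁆ : (x : Fin N) (p : Fin N → Bool) → p x ≡ true → (∀ y → remove x p y ≡ false) →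
                  ∀ y → p y ≡ ⁅ x ⁆ y
remove-empty⇒⁅⁆ x p px≡true p-x≡∅ y with x ≟ y
... | yes refl = px≡true
... | no  x≢y  = trans (sym (remove-≢ p x≢y)) (p-x≡∅ y)

member⊎empty : (p : Fin N → Bool) → (∃ λ x → p x ≡ true) ⊎ (∀ x → p x ≡ false)
member⊎empty p with any? (λ x → p x Bool.≟ true)
... | yes ∃x = inj₁ ∃x
... | no  ∄x = inj₂ (λ x → ¬-not (λ px → ∄x (x , px)))

count-cong : {p q : Fin N → Bool} → (∀ i → p i ≡ q i) → count p ≡ count q
count-cong p≗q = sum-cong-≗ (cong bit ∘ p≗q)

count-false : count {N} (λ _ → false) ≡ 0
count-false {N} = sum-replicate-zero N

∑-⁅⁆ : (x : Fin N) (g : Fin N → ℕ) → sum (λ v → bit (⁅ x ⁆ v) * g v) ≡ g x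
∑-⁅⁆ {suc N} zero    g =
  trans (cong₂ _+_ (+-identityʳ (g zero)) (sum-replicate-zero N)) (+-identityʳ (g zero))
∑-⁅⁆ {suc N} (suc x) g = begin
  sum (λ v → bit (⁅ suc x ⁆ (suc v)) * g (suc v))
    ≡⟨ sum-cong-≗ (λ v → cong (λ b → bit b * g (suc v)) (⁅suc⁆suc x v)) ⟩
  sum (λ v → bit (⁅ x ⁆ v) * g (suc v))
    ≡⟨ ∑-⁅⁆ x (g ∘ suc) ⟩
  g (suc x)
    ∎
  where open ≡-Reasoning

count-⁅⁆ : (x : Fin N) → count ⁅ x ⁆ ≡ 1
count-⁅⁆ x = trans (sum-cong-≗ (λ v → sym (*-identityʳ (bit (⁅ x ⁆ v))))) (∑-⁅⁆ x (λ _ → 1))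

∑-fibres : (f : Fin M → Fin N) (g : Fin N → ℕ) →
           sum (g ∘ f) ≡ sum (λ v → count (λ e → ⁅ f e ⁆ v) * g v)
∑-fibres {M} {N} f g = begin
  sum (g ∘ f)                                     ≡⟨ sum-cong-≗ (λ e → ∑-⁅⁆ (f e) g) ⟨
  sum (λ e → sum (λ v → bit (⁅ f e ⁆ v) * g v))  ≡⟨ ∑-comm (λ e v → bit (⁅ f e ⁆ v) * g v) ⟩
  sum (λ v → sum (λ e → bit (⁅ f e ⁆ v) * g v))  ≡⟨ sum-cong-≗ (λ v → *-distribʳ-sum (g v) (fibre v)) ⟨
  sum (λ v → count (λ e → ⁅ f e ⁆ v) * g v)      ∎
  where
  open ≡-Reasoning
  fibre : Fin N → Fin M → ℕ
  fibre v e = bit (⁅ f e ⁆ v)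

bit-∨-∧ : ∀ a b → bit (a ∨ b) + bit (a ∧ b) ≡ bit a + bit b
bit-∨-∧ true  true  = refl
bit-∨-∧ true  false = refl
bit-∨-∧ false true  = refl
bit-∨-∧ false false = refl

count-∪-∩ : (p q : Fin N → Bool) → count (p ∪ q) + count (p ∩ q) ≡ count p + count q
count-∪-∩ p q = begin
  count (p ∪ q) + count (p ∩ q)                  ≡⟨ ∑-distrib-+ (bit ∘ (p ∪ q)) (bit ∘ (p ∩ q)) ⟨
  sum (λ i → bit (p i ∨ q i) + bit (p i ∧ q i))  ≡⟨ sum-cong-≗ (λ i → bit-∨-∧ (p i) (q i)) ⟩
  sum (λ i → bit (p i) + bit (q i))              ≡⟨ ∑-distrib-+ (bit ∘ p) (bit ∘ q) ⟩
  count p + count q                              ∎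
  where open ≡-Reasoning

count-∪-disjoint : (p q : Fin N → Bool) → (∀ i → (p ∩ q) i ≡ false) →
                   count (p ∪ q) ≡ count p + count q
count-∪-disjoint {N} p q p∩q≗∅ = begin
  count (p ∪ q)                  ≡⟨ +-identityʳ _ ⟨
  count (p ∪ q) + 0              ≡⟨ cong (count (p ∪ q) +_) (trans (count-cong p∩q≗∅) (count-false {N})) ⟨
  count (p ∪ q) + count (p ∩ q)  ≡⟨ count-∪-∩ p q ⟩
  count p + count q              ∎
  where open ≡-Reasoning

count-insert : (x : Fin N) (p : Fin N → Bool) → p x ≡ false → count (insert x p) ≡ suc (count p)
count-insert x p px≡false = begin
  count (p ∪ ⁅ x ⁆)        ≡⟨ count-∪-disjoint p ⁅ x ⁆ disjoint ⟩
  count p + count ⁅ x ⁆   ≡⟨ cong (count p +_) (count-⁅⁆ x) ⟩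
  count p + 1             ≡⟨ +-comm (count p) 1 ⟩
  suc (count p)           ∎
  where
  open ≡-Reasoning
  disjoint : ∀ i → p i ∧ ⁅ x ⁆ i ≡ false
  disjoint i with x ≟ i
  ... | yes refl = cong (_∧ true) px≡false
  ... | no  _    = ∧-zeroʳ (p i)

count-remove : (x : Fin N) (p : Fin N → Bool) → p x ≡ true → suc (count (remove x p)) ≡ count p
count-remove x p px≡true =
  trans (sym (count-insert x (remove x p) (remove-self x p))) (count-cong (insert-remove x p px≡true))

setInduction : (P : (Fin N → Bool) → Set ℓ) →
               (∀ {p q} → (∀ i → p i ≡ q i) → P p → P q) →
               P (λ _ → false) →
               (∀ x p → p x ≡ false → P p → P (insert x p)) →
               ∀ p → P p
setInduction P resp P∅ P-insert p = go (count p) p refl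
  where
  go : ∀ k p → count p ≡ k → P p
  go k p count≡k with member⊎empty p
  ... | inj₂ p≡∅ = resp (sym ∘ p≡∅) P∅
  go zero    p count≡k | inj₁ (x , px) = contradiction (trans (count-remove x p px) count≡k) λ ()
  go (suc k) p count≡k | inj₁ (x , px) =
    resp (insert-remove x p px)
         (P-insert x (remove x p) (remove-self x p)
                   (go k (remove x p) (ℕ.suc-injective (trans (count-remove x p px) count≡k))))

count-positive : (p : Fin N → Bool) (x : Fin N) → p x ≡ true → 0 < count p
count-positive p x px = ≤-trans (s≤s z≤n) (≤-reflexive (count-remove x p px))

count-witness : (p : Fin N → Bool) → 0 < count p → ∃ λ x → p x ≡ true
count-witness {N} p 0<count with member⊎empty p
... | inj₁ ∃x  = ∃x
... | inj₂ p≡∅ = contradiction (trans (count-cong p≡∅) (count-false {N})) (>⇒≢ 0<count)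

bit-mono : {a b : Bool} → (a ≡ true → b ≡ true) → bit a ≤ bit b
bit-mono {false}        _   = z≤n
bit-mono {true} {true}  _   = ≤-refl
bit-mono {true} {false} a⇒b = contradiction (a⇒b refl) λ ()

count-mono : {p q : Fin N → Bool} → (∀ x → p x ≡ true → q x ≡ true) → count p ≤ count q
count-mono {zero}  p⊆q = z≤n
count-mono {suc N} p⊆q = +-mono-≤ (bit-mono (p⊆q zero)) (count-mono (p⊆q ∘ suc))

count-injection : {p : Fin N → Bool} {q : Fin M → Bool} (f : ∀ x → p x ≡ true → Fin M) →
                  (∀ x px → q (f x px) ≡ true) →
                  (∀ {x y} px py → f x px ≡ f y py → x ≡ y) →
                  count p ≤ count q
count-injection {N = zero} f f∈q f-inj = z≤n
count-injection {N = suc N} {M} {p} {q} f f∈q f-inj with p zero in p0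
... | false = count-injection (f ∘ suc) (f∈q ∘ suc) (λ px py → suc-injective ∘ f-inj px py)
... | true  = begin
  suc (count (p ∘ suc))
    ≤⟨ s≤s (count-injection (f ∘ suc) f∘suc∈q-y (λ px py → suc-injective ∘ f-inj px py)) ⟩
  suc (count (remove y q))
    ≡⟨ count-remove y q (f∈q zero p0) ⟩
  count q
    ∎
  where
  open ≤-Reasoning
  y : Fin M
  y = f zero p0
  f∘suc∈q-y : ∀ x px → remove y q (f (suc x) px) ≡ true
  f∘suc∈q-y x px = trans (remove-≢ q (λ y≡ → 0≢1+n (f-inj p0 px y≡))) (f∈q (suc x) px)

∣tabulate∣≡count : (p : Fin N → Bool) → ∣ tabulate p ∣ ≡ count p
∣tabulate∣≡count {zero}  p = refl
∣tabulate∣≡count {suc N} p with p zero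
... | true  = cong suc (∣tabulate∣≡count (p ∘ suc))
... | false = ∣tabulate∣≡count (p ∘ suc)

∣∣≡count : (A : Subset N) → ∣ A ∣ ≡ count (lookup A)
∣∣≡count A = trans (cong ∣_∣ (sym (tabulate∘lookup A))) (∣tabulate∣≡count (lookup A))

∈⇒lookup : {x : Fin N} {A : Subset N} → x ∈ A → lookup A x ≡ true
∈⇒lookup = []=⇒lookup

lookup⇒∈ : {x : Fin N} {A : Subset N} → lookup A x ≡ true → x ∈ A
lookup⇒∈ = lookup⇒[]= _ _

lookup-∁ : (A : Subset N) (x : Fin N) → lookup (∁ A) x ≡ not (lookup A x)
lookup-∁ A x = lookup-map x not A

⊆⇒⊂⊎≡ : {B A : Subset N} → B ⊆ A → B ⊂ A ⊎ B ≡ A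
⊆⇒⊂⊎≡ {B = B} {A} B⊆A with any? (λ x → x ∈? A ×-dec ¬? (x ∈? B))
... | yes (x , x∈A , x∉B) = inj₁ (B⊆A , x , x∈A , x∉B)
... | no  ∄x              = inj₂ (⊆-antisym B⊆A A⊆B)
  where
  A⊆B : A ⊆ B
  A⊆B {x} x∈A with x ∈? B
  ... | yes x∈B = x∈B
  ... | no  x∉B = contradiction (x , x∈A , x∉B) ∄x

balanced-≤ : ∀ {x y a b} → x + b ≡ y + a → x ≤ y ⇔ a ≤ b
balanced-≤ {x} {y} {a} {b} x+b≡y+a = mk⇔
  (λ x≤y → +-cancelˡ-≤ y a b (≤-trans (≤-reflexive (sym x+b≡y+a)) (+-monoˡ-≤ b x≤y)))
  (λ a≤b → +-cancelʳ-≤ b x y (≤-trans (≤-reflexive x+b≡y+a) (+-monoʳ-≤ y a≤b)))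

balanced-≡ : ∀ {x y a b} → x + b ≡ y + a → x ≡ y ⇔ a ≡ b
balanced-≡ {x} {y} {a} {b} x+b≡y+a = mk⇔
  (λ x≡y → +-cancelˡ-≡ y a b (trans (sym x+b≡y+a) (cong (_+ b) x≡y)))
  (λ a≡b → +-cancelʳ-≡ b x y (trans x+b≡y+a (cong (y +_) a≡b)))

bond-balance : ∀ s d {r₁ r₀ c n} → r₁ + c ≡ n → r₀ + 1 ≡ n →
               (s + r₀) + (d + 1) ≡ (d + r₁) + (s + c)
bond-balance s d {r₁} {r₀} {c} r₁+c≡n r₀+1≡n = begin
  (s + r₀) + (d + 1)   ≡⟨ interchange s r₀ d 1 ⟩
  (s + d) + (r₀ + 1)   ≡⟨ cong₂ _+_ (+-comm s d) (trans r₀+1≡n (sym r₁+c≡n)) ⟩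
  (d + s) + (r₁ + c)   ≡⟨ interchange d s r₁ c ⟩
  (d + r₁) + (s + c)   ∎
  where open ≡-Reasoning

m+m≡3n⇒n<m : ∀ {m n} → m + m ≡ 3 * n → 0 < n → n < m
m+m≡3n⇒n<m {m} {n} m+m≡3n 0<n = ≰⇒> (λ m≤n → <⇒≱ 0<n (+-cancelˡ-≤ (n + n) n 0 (begin
    (n + n) + n    ≡⟨ three-times n ⟩
    3 * n          ≡⟨ m+m≡3n ⟨
    m + m          ≤⟨ +-mono-≤ m≤n m≤n ⟩
    n + n          ≡⟨ +-identityʳ (n + n) ⟨
    (n + n) + 0    ∎)))
  where
  open ≤-Reasoning
  three-times : ∀ k → (k + k) + k ≡ 3 * k
  three-times = solve-∀

forest-balance : ∀ w e {z w′} → w + e ≡ z → (z + 1) + w′ ≡ (e + w′) + (w + 1)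
forest-balance w e {w′ = w′} refl = rearrange w e w′
  where
  rearrange : ∀ w e w′ → ((w + e) + 1) + w′ ≡ (e + w′) + (w + 1)
  rearrange = solve-∀

loose-shrink : ∀ {zA zB κA κB dA dB} → zA ≡ suc zB → κA + dB ≤ κB + dA →
               dA + 1 < zA + κA → dB + 1 ≤ zB + κB
loose-shrink {_} {zB} {κA} {κB} {dA} {dB} refl κA+dB≤κB+dA dA+1<zA+κA =
  +-cancelʳ-≤ κA (dB + 1) (zB + κB) (begin
    (dB + 1) + κA     ≡⟨ regroup dB κA ⟩
    (κA + dB) + 1     ≤⟨ +-monoˡ-≤ 1 κA+dB≤κB+dA ⟩
    (κB + dA) + 1     ≡⟨ +-assoc κB dA 1 ⟩
    κB + (dA + 1)     ≤⟨ +-monoʳ-≤ κB (s≤s⁻¹ dA+1<zA+κA) ⟩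
    κB + (zB + κA)    ≡⟨ regroup′ κB zB κA ⟩
    (zB + κB) + κA    ∎)
  where
  open ≤-Reasoning
  regroup : ∀ d k → (d + 1) + k ≡ (k + d) + 1
  regroup = solve-∀
  regroup′ : ∀ k z k′ → k + (z + k′) ≡ (z + k) + k′
  regroup′ = solve-∀

larger-summand-positive : ∀ {m n o} → m + n ≡ suc o → n ≤ m → 0 < m
larger-summand-positive {zero}  refl ()
larger-summand-positive {suc m} _    _  = s≤s z≤n

loose-singleton : ∀ {κ d} → κ ≤ d → ¬ (d + 1 < 1 + κ)
loose-singleton {κ} {d} κ≤d d+1<1+κ = <-irrefl refl (begin-strict
    d + 1     <⟨ d+1<1+κ ⟩
    1 + κ     ≤⟨ +-monoʳ-≤ 1 κ≤d ⟩
    1 + d     ≡⟨ +-comm 1 d ⟩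
    d + 1     ∎)
  where open ≤-Reasoning

data InitOrLast : ∀ {k} → Fin (suc k) → Set where
  init : ∀ {k} (i : Fin k) → InitOrLast (inject₁ i)
  last : ∀ {k} → InitOrLast (fromℕ k)

initOrLast : ∀ {k} (i : Fin (suc k)) → InitOrLast i
initOrLast {zero}  zero    = last
initOrLast {suc k} zero    = init zero
initOrLast {suc k} (suc i) with initOrLast i
... | init j = init (suc j)
... | last   = last

snoc : ∀ {A : Set} {k} → (Fin k → A) → A → Fin (suc k) → A
snoc {k = zero}  xs x zero    = x
snoc {k = suc k} xs x zero    = xs zero
snoc {k = suc k} xs x (suc i) = snoc (xs ∘ suc) x i

snoc-init : ∀ {A : Set} {k} (xs : Fin k → A) x i → snoc xs x (inject₁ i) ≡ xs i
snoc-init {k = suc k} xs x zero    = refl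
snoc-init {k = suc k} xs x (suc i) = snoc-init (xs ∘ suc) x i

snoc-last : ∀ {A : Set} {k} (xs : Fin k → A) x → snoc xs x (fromℕ k) ≡ x
snoc-last {k = zero}  xs x = refl
snoc-last {k = suc k} xs x = snoc-last (xs ∘ suc) x

inject₁≡suc⇒suc≢inject₁ : ∀ {k} (i j : Fin k) → inject₁ i ≡ suc j → suc i ≢ inject₁ j
inject₁≡suc⇒suc≢inject₁ i j i≡1+j 1+i≡j = <-irrefl (sym 2+j≡j) (m<n⇒m<1+n (n<1+n (toℕ j)))
  where
  2+j≡j : suc (suc (toℕ j)) ≡ toℕ j
  2+j≡j = begin
    suc (suc (toℕ j))       ≡⟨ cong suc (trans (sym (toℕ-inject₁ i)) (cong toℕ i≡1+j)) ⟨
    suc (toℕ i)             ≡⟨ trans (cong toℕ 1+i≡j) (toℕ-inject₁ j) ⟩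
    toℕ j                   ∎
    where open ≡-Reasoning

module Walks (G : Graph) where
  open Graph G

  Walk : (Fin m → Bool) → Fin n → Fin n → Set
  Walk F = Reach G (λ e → F e ≡ true)

  reach-map : ∀ {P Q : Fin m → Set} → (∀ e → P e → Q e) → ∀ {u v} → Reach G P u v → Reach G Q u v
  reach-map P⇒Q here            = here
  reach-map P⇒Q (step e pe j r) = step e (P⇒Q e pe) j (reach-map P⇒Q r)

  reach-trans : ∀ {P : Fin m → Set} {u w v} → Reach G P u w → Reach G P w v → Reach G P u v
  reach-trans here            r′ = r′
  reach-trans (step e pe j r) r′ = step e pe j (reach-trans r r′)

  joins-sym : ∀ {e u v} → Joins G e u v → Joins G e v u
  joins-sym (inj₁ p) = inj₂ p
  joins-sym (inj₂ p) = inj₁ p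

  reach-sym : ∀ {P : Fin m → Set} {u v} → Reach G P u v → Reach G P v u
  reach-sym here            = here
  reach-sym (step e pe j r) = reach-trans (reach-sym r) (step e pe (joins-sym j) here)

  joins-unique : ∀ {e u w u′ w′} → Joins G e u w → Joins G e u′ w′ →
                 (u ≡ u′ × w ≡ w′) ⊎ (u ≡ w′ × w ≡ u′)
  joins-unique (inj₁ (refl , refl)) (inj₁ (refl , refl)) = inj₁ (refl , refl)
  joins-unique (inj₁ (refl , refl)) (inj₂ (refl , refl)) = inj₂ (refl , refl)
  joins-unique (inj₂ (refl , refl)) (inj₁ (refl , refl)) = inj₂ (refl , refl)
  joins-unique (inj₂ (refl , refl)) (inj₂ (refl , refl)) = inj₁ (refl , refl)

  record SimplePath (F : Fin m → Bool) (a b : Fin n) : Set where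
    constructor mkPath
    field
      len    : ℕ
      vs     : Fin (suc len) → Fin n
      es     : Fin len → Fin m
      start  : vs zero ≡ a
      end    : vs (fromℕ len) ≡ b
      joins  : ∀ i → Joins G (es i) (vs (inject₁ i)) (vs (suc i))
      es∈F   : ∀ i → F (es i) ≡ true
      vs-inj : ∀ i j → vs i ≡ vs j → i ≡ j

    es-inj : ∀ i j → es i ≡ es j → i ≡ j
    es-inj i j eᵢ≡eⱼ
      with joins-unique (joins i) (subst (λ e → Joins G e (vs (inject₁ j)) (vs (suc j))) (sym eᵢ≡eⱼ) (joins j))
    ... | inj₁ (vᵢ≡vⱼ , _)        = inject₁-injective (vs-inj _ _ vᵢ≡vⱼ)
    ... | inj₂ (vᵢ≡vⱼ₊₁ , vᵢ₊₁≡vⱼ) =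
      contradiction (vs-inj _ _ vᵢ₊₁≡vⱼ) (inject₁≡suc⇒suc≢inject₁ i j (vs-inj _ _ vᵢ≡vⱼ₊₁))

  open SimplePath

  trivialPath : ∀ {F a} → SimplePath F a a
  trivialPath {a = a} = record
    { len = 0 ; vs = λ _ → a ; es = λ () ; start = refl ; end = refl
    ; joins = λ () ; es∈F = λ () ; vs-inj = λ { zero zero _ → refl } }

  cons : ∀ {F u a b} e → F e ≡ true → Joins G e u a → (P : SimplePath F a b) → (∀ i → vs P i ≢ u) →
         SimplePath F u b
  cons {u = u} e e∈F e:u—a P u∉P = record
    { len    = suc (len P)
    ; vs     = u ∷ vs P
    ; es     = e ∷ es P
    ; start  = refl
    ; end    = end P
    ; joins  = λ { zero → subst (Joins G e u) (sym (start P)) e:u—a ; (suc i) → joins P i }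
    ; es∈F   = λ { zero → e∈F ; (suc i) → es∈F P i }
    ; vs-inj = λ { zero    zero    _  → refl
                 ; zero    (suc j) eq → contradiction (sym eq) (u∉P j)
                 ; (suc i) zero    eq → contradiction eq (u∉P i)
                 ; (suc i) (suc j) eq → cong suc (vs-inj P i j eq) } }

  suffix : ∀ {F a b} (P : SimplePath F a b) (i : Fin (suc (len P))) → SimplePath F (vs P i) b
  suffix (mkPath k vs es _ end joins es∈F vs-inj) zero = mkPath k vs es refl end joins es∈F vs-inj
  suffix (mkPath (suc k) vs es _ end joins es∈F vs-inj) (suc i) =
    suffix (mkPath k (vs ∘ suc) (es ∘ suc) refl end (joins ∘ suc) (es∈F ∘ suc)
                   (λ i j eq → suc-injective (vs-inj (suc i) (suc j) eq))) i

  simplify : ∀ {F u v} → Walk F u v → SimplePath F u v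
  simplify here = trivialPath
  simplify {F} {u} {v} (step {w = w} e e∈F e:u—w r) = shortcut (simplify r)
    where
    shortcut : SimplePath F w v → SimplePath F u v
    shortcut P with any? (λ i → vs P i ≟ u)
    ... | yes (i , vᵢ≡u) = subst (λ x → SimplePath F x v) vᵢ≡u (suffix P i)
    ... | no  u∉P        = cons e e∈F e:u—w P (λ i eq → u∉P (i , eq))

  CycleIn : (Fin m → Bool) → Set
  CycleIn F = Σ (CycleData G) λ C → ∀ i → F (CycleData.es C i) ≡ true

  closeCycle : ∀ {F a b} (P : SimplePath F a b) d → F d ≡ false → Joins G d b a → CycleIn (insert d F)
  closeCycle {F} P d d∉F d:b—a = C , es′∈F+d
    where
    es′ : Fin (suc (len P)) → Fin m
    es′ = snoc (es P) d
    es′-init : ∀ i → es′ (inject₁ i) ≡ es P i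
    es′-init = snoc-init (es P) d
    es′-last : es′ (fromℕ (len P)) ≡ d
    es′-last = snoc-last (es P) d
    d∉P : ∀ i → es P i ≢ d
    d∉P i eᵢ≡d = ≡true⇒≢false (trans (cong F (sym eᵢ≡d)) (es∈F P i)) d∉F
    es′-inj : ∀ i j → es′ i ≡ es′ j → i ≡ j
    es′-inj i j eq with initOrLast i | initOrLast j
    ... | init i′ | init j′ =
      cong inject₁ (es-inj P i′ j′ (trans (sym (es′-init i′)) (trans eq (es′-init j′))))
    ... | init i′ | last    = contradiction (trans (sym (es′-init i′)) (trans eq es′-last)) (d∉P i′)
    ... | last    | init j′ = contradiction (trans (sym (es′-init j′)) (trans (sym eq) es′-last)) (d∉P j′)
    ... | last    | last    = refl
    C : CycleData G
    C = record
      { len    = len P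
      ; vs     = vs P
      ; es     = es′
      ; vs-inj = vs-inj P
      ; es-inj = es′-inj
      ; joins  = λ i → subst (λ e → Joins G e _ _) (sym (es′-init i)) (joins P i)
      ; close  = subst (λ e → Joins G e _ _) (sym es′-last)
                       (subst₂ (Joins G d) (sym (end P)) (sym (start P)) d:b—a)
      }
    es′∈F+d : ∀ i → insert d F (es′ i) ≡ true
    es′∈F+d i with initOrLast i
    ... | init i′ = subst (λ e → insert d F e ≡ true) (sym (es′-init i′)) (insert-⊇ d F (es∈F P i′))
    ... | last    = subst (λ e → insert d F e ≡ true) (sym es′-last) (insert-∋ d F)

  cycle-mono : ∀ {F F′} → (∀ e → F e ≡ true → F′ e ≡ true) → CycleIn F → CycleIn F′
  cycle-mono F⊆F′ (Z , Z⊆F) = Z , λ i → F⊆F′ _ (Z⊆F i)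

module Identify {c} (a b : Fin (suc c)) (a≢b : a ≢ b) where

  redirect : Fin (suc c) → Fin (suc c)
  redirect j with j ≟ b
  ... | yes _ = a
  ... | no  _ = j

  b≢redirect : ∀ j → b ≢ redirect j
  b≢redirect j with j ≟ b
  ... | yes _   = a≢b ∘ sym
  ... | no  j≢b = j≢b ∘ sym

  redirect-b : redirect b ≡ a
  redirect-b with b ≟ b
  ... | yes _   = refl
  ... | no  b≢b = contradiction refl b≢b

  redirect-fix : ∀ j → j ≢ b → redirect j ≡ j
  redirect-fix j j≢b with j ≟ b
  ... | yes j≡b = contradiction j≡b j≢b
  ... | no  _   = refl

  identify : Fin (suc c) → Fin c
  identify j = punchOut (b≢redirect j)

  identify-a≡b : identify a ≡ identify b
  identify-a≡b = punchOut-cong b (trans (redirect-fix a a≢b) (sym redirect-b))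

  identify-onto : ∀ t → identify (punchIn b t) ≡ t
  identify-onto t = trans (punchOut-cong b (redirect-fix (punchIn b t) (punchInᵢ≢i b t))) (punchOut-punchIn b)

  identify-≡ : ∀ j j′ → identify j ≡ identify j′ →
               j ≡ j′ ⊎ ((j ≡ b × j′ ≡ a) ⊎ (j ≡ a × j′ ≡ b))
  identify-≡ j j′ eq with j ≟ b | j′ ≟ b | punchOut-injective (b≢redirect j) (b≢redirect j′) eq
  ... | yes j≡b | yes j′≡b | _    = inj₁ (trans j≡b (sym j′≡b))
  ... | yes j≡b | no _     | a≡j′ = inj₂ (inj₁ (j≡b , sym a≡j′))
  ... | no _    | yes j′≡b | j≡a  = inj₂ (inj₂ (j≡a , j′≡b))
  ... | no _    | no _     | j≡j′ = inj₁ j≡j′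

module ComponentCounting (G : Graph) where
  open Graph G
  open Walks G

  Within : (Fin n → Bool) → (Fin m → Bool) → Set
  Within S F = ∀ e → F e ≡ true → S (src e) ≡ true × S (tgt e) ≡ true

  record Components (S : Fin n → Bool) (F : Fin m → Bool) (c : ℕ) : Set where
    field
      label         : (v : Fin n) → S v ≡ true → Fin c
      label-onto    : ∀ j → ∃ λ v → Σ (S v ≡ true) λ v∈S → label v v∈S ≡ j
      label≡⇔walk   : ∀ u v (u∈S : S u ≡ true) (v∈S : S v ≡ true) →
                      (label u u∈S ≡ label v v∈S) ⇔ Walk F u v

    label-irrelevant : ∀ v (p q : S v ≡ true) → label v p ≡ label v q
    label-irrelevant v p q = from (label≡⇔walk v v p q) here

  open Components

  components-resp : ∀ {S S′ F F′ c} → (∀ v → S v ≡ S′ v) → (∀ e → F e ≡ F′ e) →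
                    Components S F c → Components S′ F′ c
  components-resp {S} {S′} {F} {F′} S≗S′ F≗F′ C = record
    { label       = λ v v∈S′ → label C v (⇐ v v∈S′)
    ; label-onto  = onto
    ; label≡⇔walk = λ u v u∈S′ v∈S′ → mk⇔
        (reach-map (λ e e∈F → trans (sym (F≗F′ e)) e∈F) ∘ to (label≡⇔walk C u v _ _))
        (from (label≡⇔walk C u v _ _) ∘ reach-map (λ e e∈F′ → trans (F≗F′ e) e∈F′))
    }
    where
    ⇐ : ∀ v → S′ v ≡ true → S v ≡ true
    ⇐ v = trans (S≗S′ v)
    onto : ∀ j → ∃ λ v → Σ (S′ v ≡ true) λ v∈S′ → label C v (⇐ v v∈S′) ≡ j
    onto j with label-onto C j
    ... | v , v∈S , lv≡j = v , trans (sym (S≗S′ v)) v∈S , trans (label-irrelevant C v _ v∈S) lv≡j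

  components-≤ : ∀ {S F c c′} → Components S F c → Components S F c′ → c ≤ c′
  components-≤ {S} {c = c} C C′ = injective⇒≤ {f = λ j → label C′ (rep j) (rep∈S j)} inj
    where
    rep : Fin c → Fin n
    rep j = proj₁ (label-onto C j)
    rep∈S : ∀ j → S (rep j) ≡ true
    rep∈S j = proj₁ (proj₂ (label-onto C j))
    inj : ∀ {j j′} → label C′ (rep j) (rep∈S j) ≡ label C′ (rep j′) (rep∈S j′) → j ≡ j′
    inj {j} {j′} eq = begin
      j                         ≡⟨ proj₂ (proj₂ (label-onto C j)) ⟨
      label C (rep j) _         ≡⟨ from (label≡⇔walk C _ _ _ _) (to (label≡⇔walk C′ _ _ _ _) eq) ⟩
      label C (rep j′) _        ≡⟨ proj₂ (proj₂ (label-onto C j′)) ⟩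
      j′                        ∎
      where open ≡-Reasoning

  components-unique : ∀ {S F c c′} → Components S F c → Components S F c′ → c ≡ c′
  components-unique C C′ = ≤-antisym (components-≤ C C′) (components-≤ C′ C)

  components-≤-n : ∀ {S F c} → Components S F c → c ≤ n
  components-≤-n {c = c} C = injective⇒≤ {f = rep} inj
    where
    rep : Fin c → Fin n
    rep j = proj₁ (label-onto C j)
    inj : ∀ {j j′} → rep j ≡ rep j′ → j ≡ j′
    inj {j} {j′} eq with label-onto C j | label-onto C j′
    inj refl | v , p , refl | .v , q , refl = label-irrelevant C v p q

  components-positive : ∀ {S F c} → Components S F c → ∀ v → S v ≡ true → 0 < c
  components-positive {c = suc c} _ _ _ = s≤s z≤n
  components-positive {c = zero}  C v v∈S with () ← label C v v∈S

  components-∅ : ∀ F → Components (λ _ → false) F 0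
  components-∅ F = record { label = λ _ () ; label-onto = λ () ; label≡⇔walk = λ _ _ () }

  within-endpoint : ∀ {S F e u w} → Within S F → F e ≡ true → Joins G e u w → S w ≡ true
  within-endpoint F⊆S e∈F (inj₁ (_ , refl)) = proj₂ (F⊆S _ e∈F)
  within-endpoint F⊆S e∈F (inj₂ (refl , _)) = proj₁ (F⊆S _ e∈F)

  walk-invariant : ∀ {S F} {X : Set} (f : (v : Fin n) → S v ≡ true → X) → Within S F →
                   (∀ e u w u∈S w∈S → F e ≡ true → Joins G e u w → f u u∈S ≡ f w w∈S) →
                   ∀ {u v} → Walk F u v → ∀ u∈S v∈S → f u u∈S ≡ f v v∈S
  walk-invariant f F⊆S f-edge {u} here p q = cong (f u) (Decidable⇒UIP.≡-irrelevant Bool._≟_ p q)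
  walk-invariant f F⊆S f-edge (step e e∈F e:u—w r) u∈S v∈S =
    trans (f-edge e _ _ u∈S w∈S e∈F e:u—w) (walk-invariant f F⊆S f-edge r w∈S v∈S)
    where w∈S = within-endpoint F⊆S e∈F e:u—w

  walk-from-outside : ∀ {S F x v} → Within S F → S x ≡ false → Walk F x v → x ≡ v
  walk-from-outside F⊆S x∉S here = refl
  walk-from-outside F⊆S x∉S (step e e∈F e:x—w _) =
    contradiction (within-endpoint F⊆S e∈F (joins-sym e:x—w)) (λ x∈S → ≡true⇒≢false x∈S x∉S)

  add-isolated : ∀ {S F c} → Components S F c → Within S F → ∀ x → S x ≡ false →
                 Components (insert x S) F (suc c)
  add-isolated {S} {F} {c} C F⊆S x x∉S = record
    { label       = λ v v∈S+x → label′ v (x ≟ v) v∈S+x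
    ; label-onto  = onto
    ; label≡⇔walk = λ u v p q → label′≡⇔walk u v (x ≟ u) (x ≟ v) p q
    }
    where
    label′ : ∀ v → Dec (x ≡ v) → insert x S v ≡ true → Fin (suc c)
    label′ v (yes _)   _      = zero
    label′ v (no  x≢v) v∈S+x = suc (label C v (trans (sym (insert-≢ S x≢v)) v∈S+x))

    onto : ∀ j → ∃ λ v → Σ (insert x S v ≡ true) λ v∈S+x → label′ v (x ≟ v) v∈S+x ≡ j
    onto zero = x , insert-∋ x S , label′-x (x ≟ x)
      where
      label′-x : (d : Dec (x ≡ x)) → label′ x d (insert-∋ x S) ≡ zero
      label′-x (yes _)   = refl
      label′-x (no  x≢x) = contradiction refl x≢x
    onto (suc j) with label-onto C j
    ... | v , v∈S , lv≡j = v , insert-⊇ x S v∈S , label′-v (x ≟ v)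
      where
      label′-v : (d : Dec (x ≡ v)) → label′ v d (insert-⊇ x S v∈S) ≡ suc j
      label′-v (yes refl) = contradiction v∈S (λ x∈S → ≡true⇒≢false x∈S x∉S)
      label′-v (no  _)    = cong suc (trans (label-irrelevant C v _ v∈S) lv≡j)

    label′≡⇔walk : ∀ u v (du : Dec (x ≡ u)) (dv : Dec (x ≡ v)) p q →
                   (label′ u du p ≡ label′ v dv q) ⇔ Walk F u v
    label′≡⇔walk u v (yes refl) (yes refl) p q = mk⇔ (λ _ → here) (λ _ → refl)
    label′≡⇔walk u v (yes refl) (no  x≢v)  p q =
      mk⇔ (λ ()) (λ r → contradiction (walk-from-outside F⊆S x∉S r) x≢v)
    label′≡⇔walk u v (no  x≢u)  (yes refl) p q =
      mk⇔ (λ ()) (λ r → contradiction (walk-from-outside F⊆S x∉S (reach-sym r)) x≢u)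
    label′≡⇔walk u v (no  _)    (no  _)    p q =
      mk⇔ (to (label≡⇔walk C u v _ _) ∘ suc-injective) (cong suc ∘ from (label≡⇔walk C u v _ _))

  add-isolated-set : ∀ {S F c} → Components S F c → Within S F →
                     ∀ U → (∀ v → U v ≡ true → S v ≡ false) → Components (S ∪ U) F (c + count U)
  add-isolated-set {S} {F} {c} C F⊆S = setInduction P resp base insert-step
    where
    P : (Fin n → Bool) → Set
    P U = (∀ v → U v ≡ true → S v ≡ false) → Components (S ∪ U) F (c + count U)

    resp : ∀ {U U′} → (∀ v → U v ≡ U′ v) → P U → P U′
    resp {U} {U′} U≗U′ PU U′∩S≡∅ =
      subst (Components (S ∪ U′) F) (cong (c +_) (count-cong U≗U′))
            (components-resp (λ v → cong (S v ∨_) (U≗U′ v)) (λ _ → refl)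
                             (PU (λ v v∈U → U′∩S≡∅ v (trans (sym (U≗U′ v)) v∈U))))

    base : P (λ _ → false)
    base _ = subst (Components (S ∪ (λ _ → false)) F)
                   (sym (trans (cong (c +_) (count-false {n})) (+-identityʳ c)))
                   (components-resp (λ v → sym (∨-identityʳ (S v))) (λ _ → refl) C)

    insert-step : ∀ x U → U x ≡ false → P U → P (insert x U)
    insert-step x U x∉U PU U+x∩S≡∅ =
      subst (Components (S ∪ insert x U) F)
            (trans (sym (+-suc c (count U))) (cong (c +_) (sym (count-insert x U x∉U))))
            (components-resp (λ v → ∨-assoc (S v) (U v) (⁅ x ⁆ v)) (λ _ → refl)
                             (add-isolated (PU (λ v → U+x∩S≡∅ v ∘ insert-⊇ x U)) F⊆S∪U x x∉S∪U))
      where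
      F⊆S∪U : Within (S ∪ U) F
      F⊆S∪U e e∈F = cong (_∨ _) (proj₁ (F⊆S e e∈F)) , cong (_∨ _) (proj₂ (F⊆S e e∈F))
      x∉S∪U : S x ∨ U x ≡ false
      x∉S∪U = cong₂ _∨_ (U+x∩S≡∅ x (insert-∋ x U)) x∉U

  edgeless : ∀ S → Components S (λ _ → false) (count S)
  edgeless S = components-resp (λ _ → refl) (λ _ → refl)
                 (add-isolated-set (components-∅ (λ _ → false)) (λ _ ()) S (λ _ _ → refl))

  insert-edge-joins : ∀ {F e d u w} → insert e F d ≡ true → Joins G d u w →
                      Walk F u w ⊎ ((u ≡ src e × w ≡ tgt e) ⊎ (u ≡ tgt e × w ≡ src e))
  insert-edge-joins {F} {e} d∈F+e d:u—w with insert⁻ e F d∈F+e | d:u—w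
  ... | inj₁ d∈F  | _                  = inj₁ (step _ d∈F d:u—w here)
  ... | inj₂ refl | inj₁ (refl , refl) = inj₂ (inj₁ (refl , refl))
  ... | inj₂ refl | inj₂ (refl , refl) = inj₂ (inj₂ (refl , refl))

  module _ {S F e} (F+e⊆S : Within S (insert e F)) where

    private
      src∈S : S (src e) ≡ true
      src∈S = proj₁ (F+e⊆S e (insert-∋ e F))
      tgt∈S : S (tgt e) ≡ true
      tgt∈S = proj₂ (F+e⊆S e (insert-∋ e F))

    merge-labels : ∀ {c c′} (C : Components S F c) (h : Fin c → Fin c′) → (∀ t → ∃ λ j → h j ≡ t) →
                   let a = label C (src e) src∈S ; b = label C (tgt e) tgt∈S in
                   h a ≡ h b →
                   (∀ j j′ → h j ≡ h j′ → j ≡ j′ ⊎ ((j ≡ b × j′ ≡ a) ⊎ (j ≡ a × j′ ≡ b))) →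
                   Components S (insert e F) c′
    merge-labels C h h-onto ha≡hb h-merges = record
      { label       = λ v p → h (label C v p)
      ; label-onto  = onto
      ; label≡⇔walk = λ u v p q →
          mk⇔ (merged⇒walk u v p q) (λ r → walk-invariant {S = S} (λ v p → h (label C v p)) F+e⊆S edge r p q)
      }
      where
      onto : ∀ t → ∃ λ v → Σ (S v ≡ true) λ p → h (label C v p) ≡ t
      onto t with h-onto t
      ... | j , hj≡t with label-onto C j
      ...   | v , p , lv≡j = v , p , trans (cong h lv≡j) hj≡t

      edge : ∀ d u w p q → insert e F d ≡ true → Joins G d u w → h (label C u p) ≡ h (label C w q)
      edge d u w p q d∈F+e d:u—w with insert-edge-joins d∈F+e d:u—w
      ... | inj₁ r                    = cong h (from (label≡⇔walk C u w p q) r)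
      ... | inj₂ (inj₁ (refl , refl)) =
        trans (cong h (label-irrelevant C _ p src∈S)) (trans ha≡hb (cong h (label-irrelevant C _ tgt∈S q)))
      ... | inj₂ (inj₂ (refl , refl)) =
        trans (cong h (label-irrelevant C _ p tgt∈S))
              (trans (sym ha≡hb) (cong h (label-irrelevant C _ src∈S q)))

      walk⁺ : ∀ u v p q → label C u p ≡ label C v q → Walk (insert e F) u v
      walk⁺ u v p q = reach-map (λ _ → insert-⊇ e F) ∘ to (label≡⇔walk C u v p q)

      merged⇒walk : ∀ u v p q → h (label C u p) ≡ h (label C v q) → Walk (insert e F) u v
      merged⇒walk u v p q eq with h-merges (label C u p) (label C v q) eq
      ... | inj₁ lu≡lv                = walk⁺ u v p q lu≡lv
      ... | inj₂ (inj₁ (lu≡b , lv≡a)) =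
        reach-trans (walk⁺ u _ p tgt∈S lu≡b)
                    (step e (insert-∋ e F) (inj₂ (refl , refl)) (walk⁺ _ v src∈S q (sym lv≡a)))
      ... | inj₂ (inj₂ (lu≡a , lv≡b)) =
        reach-trans (walk⁺ u _ p src∈S lu≡a)
                    (step e (insert-∋ e F) (inj₁ (refl , refl)) (walk⁺ _ v tgt∈S q (sym lv≡b)))

    insert-edge : ∀ {c} → Components S F c →
                  (Walk F (src e) (tgt e) × Components S (insert e F) c) ⊎
                  (∃ λ c′ → c ≡ suc c′ × Components S (insert e F) c′)
    insert-edge {zero}  C with () ← label C (src e) src∈S
    insert-edge {suc c} C with label C (src e) src∈S ≟ label C (tgt e) tgt∈S
    ... | yes a≡b = inj₁ ( to (label≡⇔walk C _ _ src∈S tgt∈S) a≡b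
                         , merge-labels C (λ j → j) (λ t → t , refl) a≡b (λ _ _ → inj₁))
    ... | no  a≢b = inj₂ ( c , refl
                         , merge-labels C identify (λ t → punchIn b t , identify-onto t) identify-a≡b identify-≡)
      where
      b : Fin (suc c)
      b = label C (tgt e) tgt∈S
      open Identify (label C (src e) src∈S) b a≢b

  -- Each added edge either merges two components or closes a cycle.  Opaque: only this statement is used.
  opaque
    components-count : ∀ S F → Within S F → ∃ λ c → Components S F c × (CycleIn F ⊎ c + count F ≡ count S)
    components-count S = setInduction P resp base insert-step
      where
      P : (Fin m → Bool) → Set
      P F = Within S F → ∃ λ c → Components S F c × (CycleIn F ⊎ c + count F ≡ count S)

      resp : ∀ {F F′} → (∀ e → F e ≡ F′ e) → P F → P F′
      resp {F} {F′} F≗F′ PF F′⊆S with PF (λ e e∈F → F′⊆S e (trans (sym (F≗F′ e)) e∈F))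
      ... | c , C , inj₁ (Z , Z⊆F) =
        c , components-resp (λ _ → refl) F≗F′ C , inj₁ (Z , λ i → trans (sym (F≗F′ _)) (Z⊆F i))
      ... | c , C , inj₂ forest    =
        c , components-resp (λ _ → refl) F≗F′ C , inj₂ (trans (cong (c +_) (sym (count-cong F≗F′))) forest)

      base : P (λ _ → false)
      base _ = count S , edgeless S , inj₂ (trans (cong (count S +_) (count-false {m})) (+-identityʳ _))

      insert-step : ∀ e F → F e ≡ false → P F → P (insert e F)
      insert-step e F e∉F PF F+e⊆S with PF (λ d d∈F → F+e⊆S d (insert-⊇ e F d∈F))
      ... | c , C , cycle-or-forest with insert-edge F+e⊆S C
      ...   | inj₁ (r , C′)         = c , C′ , inj₁ (closeCycle (simplify r) e e∉F (inj₂ (refl , refl)))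
      ...   | inj₂ (c′ , refl , C′) =
        c′ , C′ , Sum.map (cycle-mono (λ d → insert-⊇ e F {d})) forest-step cycle-or-forest
        where
        forest-step : suc c′ + count F ≡ count S → c′ + count (insert e F) ≡ count S
        forest-step forest = trans (cong (c′ +_) (count-insert e F e∉F)) (trans (+-suc c′ (count F)) forest)

  components-insert-≤ : ∀ {S F e c c′} → Within S (insert e F) →
                        Components S F c → Components S (insert e F) c′ → c ≤ suc c′
  components-insert-≤ F+e⊆S C C′ with insert-edge F+e⊆S C
  ... | inj₁ (_ , C″)        = ≤-trans (≤-reflexive (components-unique C″ C′)) (n≤1+n _)
  ... | inj₂ (_ , refl , C″) = s≤s (≤-reflexive (components-unique C″ C′))

  components-∪-≤ : ∀ {S F} T {c c′} → Within S (F ∪ T) →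
                   Components S F c → Components S (F ∪ T) c′ → c ≤ c′ + count T
  components-∪-≤ {S} {F} = setInduction P resp base insert-step
    where
    P : (Fin m → Bool) → Set
    P T = ∀ {c c′} → Within S (F ∪ T) → Components S F c → Components S (F ∪ T) c′ → c ≤ c′ + count T

    resp : ∀ {T T′} → (∀ e → T e ≡ T′ e) → P T → P T′
    resp {T} {T′} T≗T′ PT {c} {c′} F∪T′⊆S C C′ =
      subst (λ k → c ≤ c′ + k) (count-cong T≗T′)
            (PT (λ e e∈F∪T → F∪T′⊆S e (trans (cong (F e ∨_) (sym (T≗T′ e))) e∈F∪T)) C
                (components-resp (λ _ → refl) (λ e → cong (F e ∨_) (sym (T≗T′ e))) C′))

    base : P (λ _ → false)
    base {c} {c′} _ C C′ =
      ≤-trans (≤-reflexive (components-unique C (components-resp (λ _ → refl) (λ e → ∨-identityʳ (F e)) C′)))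
              (m≤m+n c′ _)

    insert-step : ∀ x T → T x ≡ false → P T → P (insert x T)
    insert-step x T x∉T PT {c} {c′} F∪T+x⊆S C C′ = begin
      c                      ≤⟨ PT F∪T⊆S C C″ ⟩
      c″ + count T           ≤⟨ +-monoˡ-≤ (count T) c″≤1+c′ ⟩
      suc c′ + count T       ≡⟨ +-suc c′ (count T) ⟨
      c′ + suc (count T)     ≡⟨ cong (c′ +_) (count-insert x T x∉T) ⟨
      c′ + count (insert x T) ∎
      where
      open ≤-Reasoning
      ∪-assoc : ∀ e → insert x (F ∪ T) e ≡ (F ∪ insert x T) e
      ∪-assoc e = ∨-assoc (F e) (T e) (⁅ x ⁆ e)
      F∪T⊆S : Within S (F ∪ T)
      F∪T⊆S e e∈F∪T = F∪T+x⊆S e (trans (sym (∪-assoc e)) (insert-⊇ x (F ∪ T) e∈F∪T))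
      c″ : ℕ
      c″ = proj₁ (components-count S (F ∪ T) F∪T⊆S)
      C″ : Components S (F ∪ T) c″
      C″ = proj₁ (proj₂ (components-count S (F ∪ T) F∪T⊆S))
      c″≤1+c′ : c″ ≤ suc c′
      c″≤1+c′ = components-insert-≤ (λ e → F∪T+x⊆S e ∘ trans (sym (∪-assoc e))) C″
                                    (components-resp (λ _ → refl) (sym ∘ ∪-assoc) C′)

module Quantities (G : Graph) where
  open Graph G
  open Walks G
  open ComponentCounting G

  incident inner : (Fin n → Bool) → Fin m → Bool
  incident S e = S (src e) ∨ S (tgt e)
  inner    S e = S (src e) ∧ S (tgt e)

  inner⊆incident : ∀ S e → inner S e ≡ true → incident S e ≡ true
  inner⊆incident S e _ with S (src e)
  ... | true = refl

  inner-within : ∀ S → Within S (inner S)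
  inner-within S e e∈S = ∧-true⁻ e∈S

  everything-within : ∀ F → Within (λ _ → true) F
  everything-within F _ _ = refl , refl

  ω : (Fin n → Bool) → ℕ
  ω S = proj₁ (components-count S (inner S) (inner-within S))

  ω-components : ∀ S → Components S (inner S) (ω S)
  ω-components S = proj₁ (proj₂ (components-count S (inner S) (inner-within S)))

  cycle⊎forest : ∀ S → CycleIn (inner S) ⊎ ω S + count (inner S) ≡ count S
  cycle⊎forest S = proj₂ (proj₂ (components-count S (inner S) (inner-within S)))

  ω-cong : ∀ {S S′} → (∀ v → S v ≡ S′ v) → ω S ≡ ω S′
  ω-cong {S} {S′} S≗S′ = components-unique
    (components-resp S≗S′ (λ e → cong₂ _∧_ (S≗S′ (src e)) (S≗S′ (tgt e))) (ω-components S))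
    (ω-components S′)

  κ : (Fin n → Bool) → ℕ
  κ S = proj₁ (components-count (λ _ → true) (not ∘ incident S) (everything-within _))

  κ-components : ∀ S → Components (λ _ → true) (not ∘ incident S) (κ S)
  κ-components S = proj₁ (proj₂ (components-count (λ _ → true) (not ∘ incident S) (everything-within _)))

  κ-cong : ∀ {S S′} → (∀ v → S v ≡ S′ v) → κ S ≡ κ S′
  κ-cong {S} {S′} S≗S′ = components-unique
    (components-resp (λ _ → refl) (λ e → cong not (cong₂ _∨_ (S≗S′ (src e)) (S≗S′ (tgt e))))
                     (κ-components S))
    (κ-components S′)

  κ≡ω∁+count : ∀ S → κ S ≡ ω (not ∘ S) + count S
  κ≡ω∁+count S = components-unique (κ-components S)
    (components-resp (λ v → ∨-inverseˡ (S v)) inner∁≡outside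
      (add-isolated-set (ω-components (not ∘ S)) (inner-within (not ∘ S)) S (λ v v∈S → cong not v∈S)))
    where
    inner∁≡outside : ∀ e → inner (not ∘ S) e ≡ not (incident S e)
    inner∁≡outside e with S (src e)
    ... | true  = refl
    ... | false = refl

  Dependent Tight Loose : (Fin n → Bool) → Set
  Dependent S = count (incident S) + 1 ≤ count S + κ S
  Tight     S = count (incident S) + 1 ≡ count S + κ S
  Loose     S = count (incident S) + 1 < count S + κ S

  degree≡ : ∀ v → degree G v ≡ count (λ e → ⁅ src e ⁆ v) + count (λ e → ⁅ tgt e ⁆ v)
  degree≡ v = cong₂ _+_ (∣tabulate∣≡count (λ e → ⁅ src e ⁆ v))
                        (∣tabulate∣≡count (λ e → ⁅ tgt e ⁆ v))

  handshake : Trivalent G → ∀ S → count (incident S) + count (inner S) ≡ 3 * count S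
  handshake trivalent S = begin
    count (incident S) + count (inner S)
      ≡⟨ count-∪-∩ (S ∘ src) (S ∘ tgt) ⟩
    count (S ∘ src) + count (S ∘ tgt)
      ≡⟨ cong₂ _+_ (∑-fibres src (bit ∘ S)) (∑-fibres tgt (bit ∘ S)) ⟩
    sum (λ v → #src v * bit (S v)) + sum (λ v → #tgt v * bit (S v))
      ≡⟨ ∑-distrib-+ (λ v → #src v * bit (S v)) (λ v → #tgt v * bit (S v)) ⟨
    sum (λ v → #src v * bit (S v) + #tgt v * bit (S v))
      ≡⟨ sum-cong-≗ degree-3 ⟩
    sum (λ v → 3 * bit (S v))
      ≡⟨ *-distribˡ-sum 3 (bit ∘ S) ⟨
    3 * count S
      ∎
    where
    open ≡-Reasoning
    #src #tgt : Fin n → ℕ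
    #src v = count (λ e → ⁅ src e ⁆ v)
    #tgt v = count (λ e → ⁅ tgt e ⁆ v)
    degree-3 : ∀ v → #src v * bit (S v) + #tgt v * bit (S v) ≡ 3 * bit (S v)
    degree-3 v = trans (sym (*-distribʳ-+ (bit (S v)) (#src v) (#tgt v)))
                       (cong (_* bit (S v)) (trans (sym (degree≡ v)) (trivalent v)))

  spanning-connected : ∀ {F} → Fin n → (∀ u v → Walk F u v) → Components (λ _ → true) F 1
  spanning-connected v₀ walk = record
    { label       = λ _ _ → zero
    ; label-onto  = λ { zero → v₀ , refl , refl }
    ; label≡⇔walk = λ u v _ _ → mk⇔ (λ _ → walk u v) (λ _ → refl)
    }

  κ≤incident+1 : Connected G → Fin n → ∀ S → κ S ≤ count (incident S) + 1
  κ≤incident+1 connected v₀ S = subst (κ S ≤_) (+-comm 1 (count (incident S)))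
    (components-∪-≤ (incident S) (everything-within _) (κ-components S)
      (components-resp (λ _ → refl) (λ e → sym (∨-inverseˡ (incident S e)))
        (spanning-connected v₀ (λ u v → reach-map (λ _ _ → refl) (connected u v)))))

  -- E − δ(A) is E − δ(B) minus the edges of δ(A) − δ(B), and each deleted edge adds at most one component.
  κ+incident-mono : ∀ A B → (∀ v → B v ≡ true → A v ≡ true) →
                    κ A + count (incident B) ≤ κ B + count (incident A)
  κ+incident-mono A B B⊆A = begin
    κ A + count (incident B)                ≤⟨ +-monoˡ-≤ (count (incident B)) κA≤κB+T ⟩
    κ B + count T + count (incident B)      ≡⟨ +-assoc (κ B) (count T) (count (incident B)) ⟩
    κ B + (count T + count (incident B))    ≡⟨ cong (κ B +_) (+-comm (count T) (count (incident B))) ⟩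
    κ B + (count (incident B) + count T)    ≡⟨ cong (κ B +_) (count-∪-disjoint (incident B) T B∩T≡∅) ⟨
    κ B + count (incident B ∪ T)            ≡⟨ cong (κ B +_) (count-cong (proj₁ ∘ partition)) ⟩
    κ B + count (incident A)                ∎
    where
    open ≤-Reasoning
    T : Fin m → Bool
    T = incident A ∩ (not ∘ incident B)
    partition : ∀ e → (incident B e ∨ T e ≡ incident A e) × (not (incident B e) ≡ not (incident A e) ∨ T e)
    partition e = ⇒-partition (∨-mono (B⊆A (src e)) (B⊆A (tgt e)))
    B∩T≡∅ : ∀ e → (incident B ∩ T) e ≡ false
    B∩T≡∅ e with incident B e
    ... | true  = ∧-zeroʳ (incident A e)
    ... | false = refl
    κA≤κB+T : κ A ≤ κ B + count T
    κA≤κB+T = components-∪-≤ T (everything-within _) (κ-components A)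
                (components-resp (λ _ → refl) (proj₂ ∘ partition) (κ-components B))

  incident-edge : Trivalent G → ∀ v → ∃ λ e → incident ⁅ v ⁆ e ≡ true
  incident-edge trivalent v = count-witness (incident ⁅ v ⁆)
    (larger-summand-positive (trans (handshake trivalent ⁅ v ⁆) (cong (3 *_) (count-⁅⁆ v)))
                             (count-mono (inner⊆incident ⁅ v ⁆)))

  -- G − e₁ is connected for an edge e₁ at v; removing the other edges at v adds at most one component each.
  κ⁅v⁆≤incident : Trivalent G → TwoEdgeConnected G → ∀ v → κ ⁅ v ⁆ ≤ count (incident ⁅ v ⁆)
  κ⁅v⁆≤incident trivalent (_ , bridgeless) v = begin
    κ ⁅ v ⁆                 ≤⟨ components-∪-≤ T (everything-within _) (κ-components ⁅ v ⁆)
                                 (components-resp (λ _ → refl) G-e₁≡rest∪T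
                                    (spanning-connected v (λ u w → reach-map avoids-e₁ (bridgeless e₁ u w)))) ⟩
    1 + count T             ≡⟨ count-remove e₁ (incident ⁅ v ⁆) e₁∈δv ⟩
    count (incident ⁅ v ⁆)  ∎
    where
    open ≤-Reasoning
    e₁ : Fin m
    e₁ = proj₁ (incident-edge trivalent v)
    e₁∈δv : incident ⁅ v ⁆ e₁ ≡ true
    e₁∈δv = proj₂ (incident-edge trivalent v)
    T : Fin m → Bool
    T = remove e₁ (incident ⁅ v ⁆)
    avoids-e₁ : ∀ e → e ≢ e₁ → not (⁅ e₁ ⁆ e) ≡ true
    avoids-e₁ e e≢e₁ = cong not (⁅x⁆y (e≢e₁ ∘ sym))
    G-e₁≡rest∪T : ∀ e → not (⁅ e₁ ⁆ e) ≡ ((not ∘ incident ⁅ v ⁆) ∪ T) e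
    G-e₁≡rest∪T e with e₁ ≟ e | incident ⁅ v ⁆ e in δe
    ... | yes refl | true  = refl
    ... | yes refl | false = contradiction δe (≡true⇒≢false e₁∈δv)
    ... | no  _    | true  = refl
    ... | no  _    | false = refl

module Translation (G : Graph) where
  open Graph G
  open Walks G
  open ComponentCounting G
  open Components
  open Quantities G

  lookup-δ : ∀ A e → lookup (δ G A) e ≡ incident (lookup A) e
  lookup-δ A = lookup∘tabulate (incident (lookup A))

  ∣δ∣≡count : ∀ A → ∣ δ G A ∣ ≡ count (incident (lookup A))
  ∣δ∣≡count A = ∣tabulate∣≡count (incident (lookup A))

  induced⇒inner : ∀ A e → InInduced G A e → inner (lookup A) e ≡ true
  induced⇒inner A e (src∈A , tgt∈A) = cong₂ _∧_ (∈⇒lookup src∈A) (∈⇒lookup tgt∈A)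

  inner⇒induced : ∀ A e → inner (lookup A) e ≡ true → InInduced G A e
  inner⇒induced A e _ with lookup A (src e) in s | lookup A (tgt e) in t
  ... | true | true = lookup⇒∈ s , lookup⇒∈ t

  numComp⇒components : ∀ {A k} → NumComp G A k → Components (lookup A) (inner (lookup A)) k
  numComp⇒components {A} (lab , onto , lab≡⇔reach) = record
    { label       = λ v p → lab v (lookup⇒∈ p)
    ; label-onto  = λ j → let (v , v∈A , lv≡j) = onto j in
                      v , ∈⇒lookup v∈A , trans (from (lab≡⇔reach v v _ v∈A) here) lv≡j
    ; label≡⇔walk = λ u v p q → mk⇔ (reach-map (induced⇒inner A) ∘ to (lab≡⇔reach u v _ _))
                                     (from (lab≡⇔reach u v _ _) ∘ reach-map (inner⇒induced A))
    }

  components⇒numComp : ∀ {A k} → Components (lookup A) (inner (lookup A)) k → NumComp G A k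
  components⇒numComp {A} C =
      (λ v v∈A → label C v (∈⇒lookup v∈A))
    , (λ j → let (v , p , lv≡j) = label-onto C j in
             v , lookup⇒∈ p , trans (label-irrelevant C v _ p) lv≡j)
    , (λ u v p q → mk⇔ (reach-map (inner⇒induced A) ∘ to (label≡⇔walk C u v _ _))
                       (from (label≡⇔walk C u v _ _) ∘ reach-map (induced⇒inner A)))

  compCond⇔ : ∀ A → CompCond G A ⇔ (ω (lookup A) + 1 ≡ ω (not ∘ lookup A))
  compCond⇔ A = mk⇔
    (λ (k , l , Nₖ , Nₗ , k+1≡l) → begin
      ω (lookup A) + 1    ≡⟨ cong (_+ 1) (components-unique (ω-components (lookup A)) (numComp⇒components Nₖ)) ⟩
      k + 1               ≡⟨ k+1≡l ⟩
      l                   ≡⟨ components-unique (numComp⇒components Nₗ) (ω-components (lookup (∁ A))) ⟩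
      ω (lookup (∁ A))    ≡⟨ ω-cong (lookup-∁ A) ⟩
      ω (not ∘ lookup A)  ∎)
    (λ ω+1≡ω∁ → ω (lookup A) , ω (lookup (∁ A))
              , components⇒numComp (ω-components (lookup A))
              , components⇒numComp (ω-components (lookup (∁ A)))
              , trans ω+1≡ω∁ (sym (ω-cong (lookup-∁ A))))
    where open ≡-Reasoning

  numCompSpan⇒components : ∀ {F c} → NumCompSpan G F c → Components (λ _ → true) (lookup F) c
  numCompSpan⇒components (lab , onto , lab≡⇔reach) = record
    { label       = λ v _ → lab v
    ; label-onto  = λ j → proj₁ (onto j) , refl , proj₂ (onto j)
    ; label≡⇔walk = λ u v _ _ → mk⇔ (reach-map (λ _ → ∈⇒lookup) ∘ to (lab≡⇔reach u v))
                                     (from (lab≡⇔reach u v) ∘ reach-map (λ _ → lookup⇒∈))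
    }

  components⇒numCompSpan : ∀ {F c} → Components (λ _ → true) (lookup F) c → NumCompSpan G F c
  components⇒numCompSpan C =
      (λ v → label C v refl)
    , (λ j → let (v , p , lv≡j) = label-onto C j in v , trans (label-irrelevant C v refl p) lv≡j)
    , (λ u v → mk⇔ (reach-map (λ _ → lookup⇒∈) ∘ to (label≡⇔walk C u v refl refl))
                   (from (label≡⇔walk C u v refl refl) ∘ reach-map (λ _ → ∈⇒lookup)))

  cycleRank⇔ : ∀ {F c} → Components (λ _ → true) (lookup F) c → ∀ r → CycleRank G F r ⇔ (r + c ≡ n)
  cycleRank⇔ C r = mk⇔
    (λ (c′ , N , r+c′≡n) → trans (cong (r +_) (components-unique C (numCompSpan⇒components N))) r+c′≡n)
    (λ r+c≡n → _ , components⇒numCompSpan C , r+c≡n)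

  -- r*(δ(A)) = |δ(A)| + r(E − δ(A)) − r(E), where r(F) = n − #components(V, F) and (V, E) is connected.
  bondRank-δ⇔ : Connected G → Fin n → ∀ A s →
                BondRank G (δ G A) s ⇔ (s + κ (lookup A) ≡ count (incident (lookup A)) + 1)
  bondRank-δ⇔ connected v₀ A s = mk⇔
    (λ (r₁ , r₀ , R₁ , R₀ , s+r₀≡∣δ∣+r₁) →
      to (balanced-≡ (bond-balance s D (to (cycleRank⇔ rest r₁) R₁) (to (cycleRank⇔ whole r₀) R₀)))
         (trans s+r₀≡∣δ∣+r₁ (cong (_+ r₁) (∣δ∣≡count A))))
    (λ s+κ≡D+1 → n ∸ κ S , n ∸ 1
               , from (cycleRank⇔ rest _) (m∸n+n≡m κ≤n)
               , from (cycleRank⇔ whole _) (m∸n+n≡m 1≤n)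
               , trans (from (balanced-≡ (bond-balance s D (m∸n+n≡m κ≤n) (m∸n+n≡m 1≤n))) s+κ≡D+1)
                       (cong (_+ (n ∸ κ S)) (sym (∣δ∣≡count A))))
    where
    S : Fin n → Bool
    S = lookup A
    D : ℕ
    D = count (incident S)
    rest : Components (λ _ → true) (lookup (∁ (δ G A))) (κ S)
    rest = components-resp (λ _ → refl) (λ e → sym (trans (lookup-∁ (δ G A) e) (cong not (lookup-δ A e))))
                           (κ-components S)
    whole : Components (λ _ → true) (lookup (allE G)) 1
    whole = components-resp (λ _ → refl) (λ e → sym (lookup∘tabulate (λ _ → true) e))
                            (spanning-connected v₀ (λ u v → reach-map (λ _ _ → refl) (connected u v)))
    κ≤n : κ S ≤ n
    κ≤n = components-≤-n (κ-components S)
    1≤n : 1 ≤ n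
    1≤n = ≤-trans (s≤s z≤n) (toℕ<n v₀)

  dep⇔dependent : Connected G → Fin n → ∀ A → Dep G A ⇔ Dependent (lookup A)
  dep⇔dependent connected v₀ A = mk⇔
    (λ (s , bondRank , s≤∣A∣) → begin
      count (incident S) + 1   ≡⟨ to (bondRank-δ⇔ connected v₀ A s) bondRank ⟨
      s + κ S                  ≤⟨ +-monoˡ-≤ (κ S) (≤-trans s≤∣A∣ (≤-reflexive (∣∣≡count A))) ⟩
      count S + κ S            ∎)
    (λ dependent → count (incident S) + 1 ∸ κ S
                 , from (bondRank-δ⇔ connected v₀ A _) (m∸n+n≡m (κ≤incident+1 connected v₀ S))
                 , ≤-trans (m≤n+o⇒m∸n≤o _ (κ S) (≤-trans dependent (≤-reflexive (+-comm (count S) (κ S)))))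
                           (≤-reflexive (sym (∣∣≡count A))))
    where
    open ≤-Reasoning
    S : Fin n → Bool
    S = lookup A

module Cycles (G : Graph) where
  open Graph G
  open Walks G
  open Quantities G
  open Translation G
  open CycleData

  vertexSet : CycleData G → Subset n
  vertexSet C = tabulate (λ v → ⌊ any? (λ i → vs C i ≟ v) ⌋)

  ∈vertexSet⇔ : ∀ (C : CycleData G) v → v ∈ vertexSet C ⇔ (∃ λ i → vs C i ≡ v)
  ∈vertexSet⇔ C v = mk⇔
    (λ v∈C → toWitness (from T-≡ (trans (sym (lookup∘tabulate _ v)) (∈⇒lookup v∈C))))
    (λ ∃i → lookup⇒∈ (trans (lookup∘tabulate _ v) (to T-≡ (fromWitness ∃i))))

  vertexSet-isCycle : ∀ (C : CycleData G) → IsCycle G (vertexSet C)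
  vertexSet-isCycle C = C , ∈vertexSet⇔ C

  vertexSet⊆ : ∀ {A} (C : CycleData G) → (∀ i → vs C i ∈ A) → vertexSet C ⊆ A
  vertexSet⊆ C vs⊆A {v} v∈C with to (∈vertexSet⇔ C v) v∈C
  ... | i , refl = vs⊆A i

  cyclic⇒cycle⊂⊎cycle : ∀ {A} → Cyclic G A → (∃ λ B → B ⊂ A × Nonempty B × IsCycle G B) ⊎ IsCycle G A
  cyclic⇒cycle⊂⊎cycle (C , vs⊆A) with ⊆⇒⊂⊎≡ (vertexSet⊆ C vs⊆A)
  ... | inj₁ C⊂A =
    inj₁ (vertexSet C , C⊂A , (vs C zero , from (∈vertexSet⇔ C _) (zero , refl)) , vertexSet-isCycle C)
  ... | inj₂ C≡A = inj₂ (subst (IsCycle G) C≡A (vertexSet-isCycle C))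

  edge-joins : ∀ (C : CycleData G) i → ∃ λ j → Joins G (es C i) (vs C i) (vs C j)
  edge-joins C i with initOrLast i
  ... | init j = suc j , joins C j
  ... | last   = zero , close C

  joins⇒inner : ∀ {S e u w} → Joins G e u w → S u ≡ true → S w ≡ true → inner S e ≡ true
  joins⇒inner (inj₁ (refl , refl)) u∈S w∈S = cong₂ _∧_ u∈S w∈S
  joins⇒inner (inj₂ (refl , refl)) u∈S w∈S = cong₂ _∧_ w∈S u∈S

  inner⇒endpoint : ∀ {S e u w} → inner S e ≡ true → Joins G e u w → S u ≡ true
  inner⇒endpoint {S} {e} _ e:u—w with S (src e) in s | S (tgt e) in t | e:u—w
  ... | true | true | inj₁ (refl , _) = s
  ... | true | true | inj₂ (_ , refl) = t

  cycleIn-inner⇒cyclic : ∀ {A} → CycleIn (inner (lookup A)) → Cyclic G A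
  cycleIn-inner⇒cyclic {A} (C , es⊆A) =
    C , λ i → lookup⇒∈ (inner⇒endpoint {S = lookup A} (es⊆A i) (proj₂ (edge-joins C i)))

  cycle-edges-inner : ∀ {S} (C : CycleData G) → (∀ i → S (vs C i) ≡ true) → ∀ i → inner S (es C i) ≡ true
  cycle-edges-inner {S} C vs⊆S i = joins⇒inner {S = S} (proj₂ (edge-joins C i)) (vs⊆S i) (vs⊆S _)

  cycle-count≤inner : ∀ {A} → IsCycle G A → count (lookup A) ≤ count (inner (lookup A))
  cycle-count≤inner {A} (C , v∈A⇔) = count-injection edge edge∈A edge-inj
    where
    index : ∀ v → lookup A v ≡ true → ∃ λ i → vs C i ≡ v
    index v v∈A = to (v∈A⇔ v) (lookup⇒∈ v∈A)
    edge : ∀ v → lookup A v ≡ true → Fin m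
    edge v v∈A = es C (proj₁ (index v v∈A))
    edge∈A : ∀ v v∈A → inner (lookup A) (edge v v∈A) ≡ true
    edge∈A v v∈A = cycle-edges-inner {S = lookup A} C (λ i → ∈⇒lookup (from (v∈A⇔ _) (i , refl))) _
    edge-inj : ∀ {v w} v∈A w∈A → edge v v∈A ≡ edge w w∈A → v ≡ w
    edge-inj {v} {w} v∈A w∈A eq with index v v∈A | index w w∈A
    ... | i , refl | j , refl = cong (vs C) (es-inj C i j eq)

module Balance (G : Graph) (trivalent : Trivalent G) where
  open Graph G
  open Quantities G

  balance : ∀ S → (count (incident S) + 1) + (count (inner S) + ω (not ∘ S)) ≡
                  (count S + κ S) + (count S + 1)
  balance S = begin
    (D + 1) + (e + ω∁)      ≡⟨ interchange D 1 e ω∁ ⟩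
    (D + e) + (1 + ω∁)      ≡⟨ cong (_+ (1 + ω∁)) (handshake trivalent S) ⟩
    3 * Z + (1 + ω∁)        ≡⟨ regroup Z ω∁ ⟩
    (Z + (ω∁ + Z)) + (Z + 1) ≡⟨ cong (λ k → (Z + k) + (Z + 1)) (κ≡ω∁+count S) ⟨
    (Z + κ S) + (Z + 1)     ∎
    where
    open ≡-Reasoning
    D e Z ω∁ : ℕ
    D  = count (incident S)
    e  = count (inner S)
    Z  = count S
    ω∁ = ω (not ∘ S)
    regroup : ∀ z w → 3 * z + (1 + w) ≡ (z + (w + z)) + (z + 1)
    regroup = solve-∀

  dependent⇔ : ∀ S → Dependent S ⇔ (count S + 1 ≤ count (inner S) + ω (not ∘ S))
  dependent⇔ S = balanced-≤ (balance S)

  tight⇔ : ∀ S → Tight S ⇔ (count S + 1 ≡ count (inner S) + ω (not ∘ S))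
  tight⇔ S = balanced-≡ (balance S)

  forest-tight⇔ : ∀ S → ω S + count (inner S) ≡ count S → Tight S ⇔ (ω S + 1 ≡ ω (not ∘ S))
  forest-tight⇔ S forest = ⇔-trans (tight⇔ S) (balanced-≡ (forest-balance (ω S) (count (inner S)) forest))

module Circuits (G : Graph) (trivalent : Trivalent G) (tec : TwoEdgeConnected G) (v₀ : Fin (Graph.n G)) where
  open Graph G
  open ComponentCounting G
  open Quantities G
  open Translation G
  open Cycles G
  open Balance G trivalent

  SeparatingForest : Subset n → Set
  SeparatingForest A = Acyclic G A × CompCond G A

  NoProper : (Subset n → Set) → Subset n → Set
  NoProper P A = ∀ B → B ⊂ A → Nonempty B → ¬ P B

  cyclic⊎forest : ∀ A → Cyclic G A ⊎ (ω (lookup A) + count (inner (lookup A)) ≡ count (lookup A))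
  cyclic⊎forest A with cycle⊎forest (lookup A)
  ... | inj₁ cycle  = inj₁ (cycleIn-inner⇒cyclic cycle)
  ... | inj₂ forest = inj₂ forest

  acyclic⇒forest : ∀ A → Acyclic G A → ω (lookup A) + count (inner (lookup A)) ≡ count (lookup A)
  acyclic⇒forest A acyclic with cyclic⊎forest A
  ... | inj₁ cyclic = contradiction cyclic acyclic
  ... | inj₂ forest = forest

  compCond⇔tight : ∀ A → Acyclic G A → CompCond G A ⇔ Tight (lookup A)
  compCond⇔tight A acyclic =
    ⇔-trans (compCond⇔ A) (⇔-sym (forest-tight⇔ (lookup A) (acyclic⇒forest A acyclic)))

  separatingForest⇒dependent : ∀ A → SeparatingForest A → Dependent (lookup A)
  separatingForest⇒dependent A (acyclic , compCond) = ≤-reflexive (to (compCond⇔tight A acyclic) compCond)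

  cycle⇒¬forest : ∀ A → IsCycle G A → Nonempty A →
                  ω (lookup A) + count (inner (lookup A)) ≢ count (lookup A)
  cycle⇒¬forest A cycle (v , v∈A) forest =
    <-irrefl refl (≤-trans (+-mono-≤ 0<ω (cycle-count≤inner cycle)) (≤-reflexive forest))
    where
    0<ω : 0 < ω (lookup A)
    0<ω = components-positive (ω-components (lookup A)) v (∈⇒lookup v∈A)

  cycle⇒dependent : ∀ A → IsCycle G A → Nonempty A → Dependent (lookup A)
  cycle⇒dependent A cycle (v , v∈A) = from (dependent⇔ S) Z+1≤e+ω∁
    where
    S : Fin n → Bool
    S = lookup A
    Z+1≤e+ω∁ : count S + 1 ≤ count (inner S) + ω (not ∘ S)
    Z+1≤e+ω∁ with member⊎empty (not ∘ S)
    ... | inj₁ (w , w∉A) =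
      +-mono-≤ (cycle-count≤inner cycle) (components-positive (ω-components (not ∘ S)) w w∉A)
    ... | inj₂ A≡V = ≤-trans (≤-reflexive (+-comm (count S) 1)) (≤-trans Z<e (m≤m+n _ _))
      where
      everywhere : ∀ w → S w ≡ true
      everywhere w = trans (sym (not-involutive (S w))) (cong not (A≡V w))
      D≡e : count (incident S) ≡ count (inner S)
      D≡e = count-cong (λ e → trans (cong (_∨ S (tgt e)) (everywhere (src e)))
                                    (sym (cong₂ _∧_ (everywhere (src e)) (everywhere (tgt e)))))
      Z<e : count S < count (inner S)
      Z<e = m+m≡3n⇒n<m (trans (cong (_+ count (inner S)) (sym D≡e)) (handshake trivalent S))
                       (count-positive S v (∈⇒lookup v∈A))

  module RemoveVertex (A : Subset n) (v : Fin n) (v∈A : v ∈ A) where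
    S : Fin n → Bool
    S = lookup A

    A-v : Subset n
    A-v = tabulate (remove v S)

    lookup-A-v : ∀ w → lookup A-v w ≡ remove v S w
    lookup-A-v = lookup∘tabulate (remove v S)

    A-v⊆A : ∀ w → lookup A-v w ≡ true → S w ≡ true
    A-v⊆A w w∈A-v = proj₁ (∧-true⁻ (trans (sym (lookup-A-v w)) w∈A-v))

    A-v⊂A : A-v ⊂ A
    A-v⊂A = (λ w∈A-v → lookup⇒∈ (A-v⊆A _ (∈⇒lookup w∈A-v)))
          , v , v∈A
          , λ v∈A-v → ≡true⇒≢false (trans (sym (lookup-A-v v)) (∈⇒lookup v∈A-v)) (remove-self v S)

    count≡1+count : count S ≡ suc (count (lookup A-v))
    count≡1+count = trans (sym (count-remove v S (∈⇒lookup v∈A))) (cong suc (count-cong (sym ∘ lookup-A-v)))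

    loose⇒A-v-dependent : Loose S → Dependent (lookup A-v)
    loose⇒A-v-dependent = loose-shrink count≡1+count (κ+incident-mono S (lookup A-v) A-v⊆A)

    A-v-empty⇒¬loose : ¬ Nonempty A-v → ¬ Loose S
    A-v-empty⇒¬loose A-v≡∅ loose =
      loose-singleton (subst₂ _≤_ (sym (κ-cong S≗⁅v⁆)) (sym D≡) (κ⁅v⁆≤incident trivalent tec v))
                      (subst (λ z → count (incident S) + 1 < z + κ S) Z≡1 loose)
      where
      S≗⁅v⁆ : ∀ w → S w ≡ ⁅ v ⁆ w
      S≗⁅v⁆ = remove-empty⇒⁅⁆ v S (∈⇒lookup v∈A)
                (λ w → ¬-not (λ w∈A-v → A-v≡∅ (w , lookup⇒∈ (trans (lookup-A-v w) w∈A-v))))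
      Z≡1 : count S ≡ 1
      Z≡1 = trans (count-cong S≗⁅v⁆) (count-⁅⁆ v)
      D≡ : count (incident S) ≡ count (incident ⁅ v ⁆)
      D≡ = count-cong (λ e → cong₂ _∨_ (S≗⁅v⁆ (src e)) (S≗⁅v⁆ (tgt e)))

  loose⇒shrinks : ∀ A → Nonempty A → Loose (lookup A) → ∃ λ B → B ⊂ A × Nonempty B × Dependent (lookup B)
  loose⇒shrinks A (v , v∈A) loose = shrink (nonempty? A-v)
    where
    open RemoveVertex A v v∈A
    shrink : Dec (Nonempty A-v) → ∃ λ B → B ⊂ A × Nonempty B × Dependent (lookup B)
    shrink (yes A-v≠∅) = A-v , A-v⊂A , A-v≠∅ , loose⇒A-v-dependent loose
    shrink (no  A-v≡∅) = contradiction loose (A-v-empty⇒¬loose A-v≡∅)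

  dependent⇒tight⊎shrinks : ∀ A → Nonempty A → Dependent (lookup A) →
                            Tight (lookup A) ⊎ ∃ λ B → B ⊂ A × Nonempty B × Dependent (lookup B)
  dependent⇒tight⊎shrinks A A≠∅ dependent with m≤n⇒m<n∨m≡n dependent
  ... | inj₁ loose = inj₂ (loose⇒shrinks A A≠∅ loose)
  ... | inj₂ tight = inj₁ tight

  dep⇔ : ∀ A → Dep G A ⇔ Dependent (lookup A)
  dep⇔ = dep⇔dependent (proj₁ tec) v₀

  circuit⇒conditions : ∀ A → Nonempty A → IsCircuit G A →
                       (IsCycle G A ⊎ SeparatingForest A) × (NoProper (IsCycle G) A × NoProper SeparatingForest A)
  circuit⇒conditions A A≠∅ (_ , depA , minimal) = cycle-or-forest , no-cycle , no-forest
    where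
    independent : ∀ B → B ⊂ A → Nonempty B → ¬ Dependent (lookup B)
    independent B B⊂A B≠∅ = minimal B B⊂A B≠∅ ∘ from (dep⇔ B)
    no-cycle : NoProper (IsCycle G) A
    no-cycle B B⊂A B≠∅ = independent B B⊂A B≠∅ ∘ (λ cycle → cycle⇒dependent B cycle B≠∅)
    no-forest : NoProper SeparatingForest A
    no-forest B B⊂A B≠∅ = independent B B⊂A B≠∅ ∘ separatingForest⇒dependent B
    A-is-cycle : Cyclic G A → IsCycle G A
    A-is-cycle cyclic with cyclic⇒cycle⊂⊎cycle cyclic
    ... | inj₁ (B , B⊂A , B≠∅ , cycle) = contradiction cycle (no-cycle B B⊂A B≠∅)
    ... | inj₂ cycle                   = cycle
    cycle-or-forest : IsCycle G A ⊎ SeparatingForest A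
    cycle-or-forest with cyclic⊎forest A
    ... | inj₁ cyclic = inj₁ (A-is-cycle cyclic)
    ... | inj₂ forest = inj₂ (acyclic , from (compCond⇔tight A acyclic) tight)
      where
      acyclic : Acyclic G A
      acyclic cyclic = cycle⇒¬forest A (A-is-cycle cyclic) A≠∅ forest
      tight : Tight (lookup A)
      tight with dependent⇒tight⊎shrinks A A≠∅ (to (dep⇔ A) depA)
      ... | inj₁ tight                     = tight
      ... | inj₂ (B , B⊂A , B≠∅ , depB) = contradiction depB (independent B B⊂A B≠∅)

  cycle⊎separating⇒dependent : ∀ A → Nonempty A → IsCycle G A ⊎ SeparatingForest A → Dependent (lookup A)
  cycle⊎separating⇒dependent A A≠∅ (inj₁ cycle)      = cycle⇒dependent A cycle A≠∅
  cycle⊎separating⇒dependent A A≠∅ (inj₂ separating) = separatingForest⇒dependent A separating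

  conditions⇒circuit : ∀ A → Nonempty A →
                       (IsCycle G A ⊎ SeparatingForest A) × (NoProper (IsCycle G) A × NoProper SeparatingForest A) →
                       IsCircuit G A
  conditions⇒circuit A A≠∅ (cycle-or-forest , no-cycle , no-forest) =
    A≠∅ , from (dep⇔ A) (cycle⊎separating⇒dependent A A≠∅ cycle-or-forest)
        , λ B B⊂A B≠∅ → independent B (⊂-wellFounded B) B⊂A B≠∅ ∘ to (dep⇔ B)
    where
    acyclic : ∀ B → B ⊂ A → Acyclic G B
    acyclic B B⊂A cyclic@(C , vs⊆B) with cyclic⇒cycle⊂⊎cycle cyclic
    ... | inj₁ (B′ , B′⊂B , B′≠∅ , cycle) = no-cycle B′ (⊂-trans B′⊂B B⊂A) B′≠∅ cycle
    ... | inj₂ cycle                     = no-cycle B B⊂A (CycleData.vs C zero , vs⊆B zero) cycle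
    independent : ∀ B → Acc _⊂_ B → B ⊂ A → Nonempty B → ¬ Dependent (lookup B)
    independent B (acc smaller) B⊂A B≠∅ depB with dependent⇒tight⊎shrinks B B≠∅ depB
    ... | inj₁ tight = no-forest B B⊂A B≠∅ (acyclic B B⊂A , from (compCond⇔tight B (acyclic B B⊂A)) tight)
    ... | inj₂ (B′ , B′⊂B , B′≠∅ , depB′) =
      independent B′ (smaller B′⊂B) (⊂-trans B′⊂B B⊂A) B′≠∅ depB′

proposition3p1 : (G : Graph) → Trivalent G → TwoEdgeConnected G →
    (A : Subset (Graph.n G)) → Nonempty A →
    IsCircuit G A ⇔
      ((IsCycle G A ⊎ (Acyclic G A × CompCond G A)) ×
       ((∀ B → B ⊂ A → Nonempty B → ¬ IsCycle G B) ×
        (∀ B → B ⊂ A → Nonempty B → ¬ (Acyclic G B × CompCond G B))))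
proposition3p1 G trivalent tec A A≠∅@(v₀ , _) =
  mk⇔ (circuit⇒conditions A A≠∅) (conditions⇒circuit A A≠∅)
  where open Circuits G trivalent tec v₀
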